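{- Let $Q$ be a bipartite toroidal quadrangulation that is essentially irreducible, endowed with an S-quad 3-biorientation. Let $W$ be a closed walk of length $2k$ on $Q$ enclosing on its right a region $R$ homeomorphic to an open disk. Then $cw(W)+o(W)=3(k-1)$.
   Context: Toroidal maps: connected graphs (loops, multiple edges allowed) embedded on the torus, faces homeomorphic to open disks. A quadrangulation has all faces of degree 4; bipartite: black/white vertex coloring with edges joining different colors; essentially irreducible: every closed walk enclosing on its right a region homeomorphic to an open disk has length $\ge 4$, with equality only if the region is a single face. A biorientation assigns each half-edge outgoing or ingoing so that each edge has an outgoing half; edges with an ingoing half are simply directed. A 3-biorientation: every vertex has exactly 3 outgoing half-edges; S-quad: every face has exactly one simply directed edge having that face on its left when traversed in its direction. For $W$ as in the claim, $cw(W)$ (resp. $ccw(W)$) is the number of outgoing half-edges of $W$ encountered just after (resp. just before) a vertex while walking along $W$ around $R$, and $o(W)$ is the number of outgoing half-edges lying in the interior of $R$ and incident to a vertex of $W$. -}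

module Defs where

open import Data.Nat using (ℕ; zero; suc; _+_; _*_; _∸_; _≤_; _<_; _≤ᵇ_)
open import Data.Bool using (Bool; true; false; not; _∧_; _∨_; if_then_else_)
open import Data.Fin using (Fin; toℕ)
open import Data.Fin.Properties using (_≟_)
open import Data.List using (List; map; upTo; allFin; takeWhileᵇ; length; filterᵇ)
open import Data.Bool.ListAction using (any; all)
open import Data.Nat.ListAction using (sum)
open import Data.Product using (Σ; _×_; ∃; ∃-syntax)
open import Relation.Nullary using (¬_)
open import Relation.Nullary.Decidable using (isYes)
open import Relation.Binary.PropositionalEquality using (_≡_)
open import Function using (Injective)

iter : ∀ {A : Set} → (A → A) → ℕ → A → A
iter f zero    x = x
iter f (suc j) x = f (iter f j x)

_==_ : ∀ {n} → Fin n → Fin n → Bool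
x == y = isYes (x ≟ y)

countᵇ : ∀ {A : Set} → (A → Bool) → List A → ℕ
countᵇ p xs = length (filterᵇ p xs)

-- Darts (= half-edges) are Fin n.  α is the fixed-point-free involution
-- sending a dart to the other half of its edge; σ is the counterclockwise
-- rotation of darts around their (tail) vertex.  A dart d is the half-edge
-- at its tail vertex; traversing d means going from its tail to the tail
-- of α d.  Vertices = σ-orbits, edges = α-orbits, faces = φ-orbits where
-- φ = σ ∘ α; the φ-orbit of d is the face lying on the RIGHT of d.
-- Faces of a combinatorial map are automatically open disks; loops and
-- multiple edges are allowed.

data Reach {n : ℕ} (σ α : Fin n → Fin n) (d : Fin n) : Fin n → Set where
  here  : Reach σ α d d
  stepσ : ∀ {e} → Reach σ α d e → Reach σ α d (σ e)
  stepα : ∀ {e} → Reach σ α d e → Reach σ α d (α e)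

record Map : Set where
  field
    n         : ℕ
    α         : Fin n → Fin n
    σ         : Fin n → Fin n
    α-invol   : ∀ d → α (α d) ≡ d
    α-nofix   : ∀ d → ¬ (α d ≡ d)
    σ-inj     : Injective _≡_ _≡_ σ
    connected : ∀ d e → Reach σ α d e

module _ (M : Map) where
  open Map M

  φ : Fin n → Fin n
  φ d = σ (α d)

  darts : List (Fin n)
  darts = allFin n

  -- e lies in the f-orbit of d  (orbits of permutations of Fin n have size ≤ n)
  inOrbit : (Fin n → Fin n) → Fin n → Fin n → Bool
  inOrbit f d e = any (λ j → iter f j d == e) (upTo n)

  sameVertex : Fin n → Fin n → Bool
  sameVertex = inOrbit σ

  sameFace : Fin n → Fin n → Bool
  sameFace = inOrbit φ

  isRep : (Fin n → Fin n) → Fin n → Bool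
  isRep f d = all (λ j → toℕ d ≤ᵇ toℕ (iter f j d)) (upTo n)

  #V : ℕ
  #V = countᵇ (isRep σ) darts

  #F : ℕ
  #F = countᵇ (isRep φ) darts

  -- Euler's formula V - E + F = 0 with E = n/2 (genus 1, orientable)
  Toroidal : Set
  Toroidal = 2 * (#V + #F) ≡ n

  Quadrangulation : Set
  Quadrangulation = ∀ d → (iter φ 4 d ≡ d) × ¬ (φ d ≡ d) × ¬ (iter φ 2 d ≡ d)

  Bipartite : Set
  Bipartite = Σ (Fin n → Bool) λ colour →
    (∀ d → colour (σ d) ≡ colour d) × (∀ d → ¬ (colour (α d) ≡ colour d))

  -- A closed walk of length L is given by its darts W 0 , … , W (L-1),
  -- with W L ≡ W 0 (indices ≥ L only used for W L).
  -- A candidate region is a set of darts R : the darts whose right face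
  -- belongs to the region (so R is a union of faces).

  module _ (L : ℕ) (W : ℕ → Fin n) where

    onW : Fin n → Bool
    onW d = any (λ i → (W i == d) ∨ (W i == α d)) (upTo L)

    visited : Fin n → Bool
    visited d = any (λ i → sameVertex (W i) d) (upTo L)

    -- darts strictly inside the corner on the right of W between its
    -- arrival α (W i) and its departure W (suc i), listed counterclockwise
    -- from α (W i) (i.e. σ¹ (α (W i)), σ² (α (W i)), … until W (suc i)).
    rightCorner : ℕ → List (Fin n)
    rightCorner i =
      takeWhileᵇ (λ x → not (x == W (suc i)))
                 (map (λ j → iter σ (suc j) (α (W i))) (upTo n))

    module _ (R : Fin n → Bool) where

      -- connectivity of the open region: faces of R glued along interior edges
      data RConn (d : Fin n) : Fin n → Set where
        here   : RConn d d
        stepφ  : ∀ {e} → RConn d e → RConn d (φ e)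
        stepα  : ∀ {e} → RConn d e → R e ≡ true → onW e ≡ false → RConn d (α e)

      -- cells of the open region (cells of Q not on W, surrounded by R)
      #Fint : ℕ
      #Fint = countᵇ (λ d → R d ∧ isRep φ d) darts

      #Eint : ℕ
      #Eint = countᵇ (λ d → R d ∧ R (α d) ∧ not (onW d) ∧ (toℕ d <ᵇ' toℕ (α d))) darts
        where
        _<ᵇ'_ : ℕ → ℕ → Bool
        a <ᵇ' b = suc a ≤ᵇ b

      #Vint : ℕ
      #Vint = countᵇ (λ d → R d ∧ isRep σ d ∧ not (visited d)) darts

      record EnclosesDisk : Set where
        field
          nonempty   : 1 ≤ L
          closed     : W L ≡ W 0
          distinct   : ∀ i j → i < j → j < L → ¬ (W i ≡ W j)
          -- consecutive darts: W (i+1) is reached from the arrival α (W i)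
          -- by turning counterclockwise m ≥ 1 times, all darts strictly in
          -- between lying in the interior of the region (not on W)
          step       : ∀ i → i < L → ∃[ m ] (1 ≤ m × W (suc i) ≡ iter σ m (α (W i))
                         × (∀ j → 1 ≤ j → j < m → onW (iter σ j (α (W i))) ≡ false))
          R-faces    : ∀ d → R d ≡ true → R (φ d) ≡ true
          R-cross    : ∀ d → R d ≡ true → onW d ≡ false → R (α d) ≡ true
          W-right    : ∀ i → i < L → R (W i) ≡ true
          boundary   : ∀ d → R d ≡ true → onW d ≡ true → ∃[ i ] (i < L × W i ≡ d)
          R-conn     : ∀ d e → R d ≡ true → R e ≡ true → RConn d e
          -- connected open orientable surface of Euler characteristic 1
          euler      : #Vint + #Fint ≡ #Eint + 1

  EssentiallyIrreducible : Set
  EssentiallyIrreducible = ∀ L W R → EnclosesDisk L W R →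
    (4 ≤ L) × (L ≡ 4 → ∃[ e ] (∀ d → R d ≡ sameFace e d))

  -- Biorientations: out d ≡ true iff the half-edge d is outgoing.

  Biorientation : (Fin n → Bool) → Set
  Biorientation out = ∀ d → out d ∨ out (α d) ≡ true

  ThreeBiorientation : (Fin n → Bool) → Set
  ThreeBiorientation out = Biorientation out ×
    (∀ d → countᵇ (λ e → sameVertex d e ∧ out e) darts ≡ 3)

  -- a dart d traverses a simply directed edge in its direction iff d is
  -- outgoing and α d is ingoing; the face on its left is the face of α d.
  SQuad : (Fin n → Bool) → Set
  SQuad out = ∀ f → countᵇ (λ e → sameFace f e ∧ not (out e) ∧ out (α e)) darts ≡ 1

  -- cw(W): outgoing half-edges of W just after a vertex
  cw : (Fin n → Bool) → (L : ℕ) → (ℕ → Fin n) → ℕ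
  cw out L W = countᵇ (λ i → out (W i)) (upTo L)

  -- o(W): outgoing half-edges in the interior of R incident to a vertex of W
  o : (Fin n → Bool) → (L : ℕ) → (ℕ → Fin n) → ℕ
  o out L W = sum (map (λ i → countᵇ out (rightCorner L W i)) (upTo L))

-- Double counting of the darts (half-edges) whose right face lies in the disk R.  There are
-- 4F of them, F being the number of inner faces.  Those on the walk are exactly its L darts,
-- cw(W) of them outgoing; the others are interior, pair up into the E inner edges, and their
-- outgoing ones are the o(W) darts in the right corners of W plus three at each of the V inner
-- vertices.  An ingoing half-edge of a biorientation lies on a simply directed edge, so by the
-- S-quad condition each inner face holds exactly one ingoing dart: F ingoing darts in all.
-- With Euler's relation V + F = E + 1 for the disk these linear relations give
-- 2 (cw(W) + o(W) + 3) = 3L.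

module Submission where

open import Defs
open import Data.Nat using (ℕ; zero; suc; _+_; _*_; _∸_; _≤_; _<_; _≤ᵇ_; z≤n; s≤s; _<?_; NonZero; >-nonZero)
open import Data.Nat.Properties hiding (_≟_)
open import Data.Nat.DivMod using (_%_; _/_; m≡m%n+[m/n]*n; m%n<n)
open import Data.Nat.ListAction using () renaming (sum to sumᴸ)
open import Data.Nat.Tactic.RingSolver using (solve)
open import Data.Bool using (Bool; true; false; not; _∧_; _∨_; T)
open import Data.Bool.Properties
  using (T-≡; ∧-identityʳ; ∧-zeroʳ; ∧-comm; ∨-comm; not-involutive; ⇔→≡; ∧-commutativeMonoid)
open import Data.Bool.ListAction using (any; all; or)
open import Data.Fin using (Fin; toℕ; fromℕ<) renaming (zero to fz; suc to fs)
open import Data.Fin.Properties using (_≟_; toℕ<n; toℕ-fromℕ<; toℕ-injective; pigeonhole)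
open import Data.Fin.Permutation using (permutation)
open import Data.List using ([]; _∷_; map; upTo; allFin; applyUpTo; tabulate; takeWhileᵇ)
open import Data.List.Properties using (map-upTo; map-cong)
open import Data.List.Relation.Unary.Any.Properties using (any⁺; any⁻; applyUpTo⁺; applyUpTo⁻)
open import Data.List.Relation.Unary.All.Properties using (all⁺) renaming (applyUpTo⁻ to All-applyUpTo⁻)
open import Data.Product using (_×_; _,_; ∃-syntax; proj₁; proj₂)
open import Data.Sum using (_⊎_; inj₁; inj₂)
open import Data.Empty using (⊥-elim)
open import Relation.Nullary using (¬_; yes; no; ofʸ; ofⁿ)
open import Relation.Binary.PropositionalEquality hiding ([_])
open import Relation.Binary.Definitions using (tri<; tri≈; tri>)
open import Function using (_∘_; Equivalence; Injective; mk⇔)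
open import Algebra.Bundles using (CommutativeMonoid)
open import Algebra.Properties.CommutativeSemigroup (CommutativeMonoid.commutativeSemigroup ∧-commutativeMonoid)
  using (x∙yz≈z∙xy; xy∙z≈x∙zy; xy∙z≈xz∙y)
open import Algebra.Properties.Semiring.Sum +-*-semiring
  using (sum-syntax; sum-cong-≗; ∑-comm; ∑-distrib-+; *-distribˡ-sum; *-distribʳ-sum; sum-permute; sum-replicate-zero)

true≢false : ¬ true ≡ false
true≢false ()

∧-true⁻ : ∀ a {b} → a ∧ b ≡ true → a ≡ true × b ≡ true
∧-true⁻ true b≡true = refl , b≡true

==⇒≡ : ∀ {n} {x y : Fin n} → (x == y) ≡ true → x ≡ y
==⇒≡ {x = x} {y} eq with x ≟ y
... | yes x≡y = x≡y

≡⇒== : ∀ {n} {x y : Fin n} → x ≡ y → (x == y) ≡ true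
≡⇒== {x = x} {y} x≡y with x ≟ y
... | yes _  = refl
... | no x≢y = ⊥-elim (x≢y x≡y)

≢⇒== : ∀ {n} {x y : Fin n} → ¬ x ≡ y → (x == y) ≡ false
≢⇒== {x = x} {y} x≢y with x ≟ y
... | yes x≡y = ⊥-elim (x≢y x≡y)
... | no  _   = refl

any-upTo⁻ : (p : ℕ → Bool) (L : ℕ) → any p (upTo L) ≡ true → ∃[ i ] (i < L × p i ≡ true)
any-upTo⁻ p L eq =
  let i , i<L , pi = applyUpTo⁻ (λ i → i) (any⁻ p (upTo L) (Equivalence.from T-≡ eq))
  in  i , i<L , Equivalence.to T-≡ pi

any-upTo⁺ : (p : ℕ → Bool) (L : ℕ) {i : ℕ} → i < L → p i ≡ true → any p (upTo L) ≡ true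
any-upTo⁺ p L i<L pi = Equivalence.to T-≡ (any⁺ p (applyUpTo⁺ (λ i → i) (Equivalence.from T-≡ pi) i<L))

all-upTo⁻ : (p : ℕ → Bool) (L : ℕ) → all p (upTo L) ≡ true → ∀ {i} → i < L → p i ≡ true
all-upTo⁻ p L eq i<L =
  Equivalence.to T-≡ (All-applyUpTo⁻ (λ i → i) L (all⁺ p (upTo L) (Equivalence.from T-≡ eq)) i<L)

all-upTo-false : (p : ℕ → Bool) (L : ℕ) → all p (upTo L) ≡ false → ∃[ i ] (i < L × p i ≡ false)
all-upTo-false p = go (λ i → i)
  where
  go : (f : ℕ → ℕ) (L : ℕ) → all p (applyUpTo f L) ≡ false → ∃[ i ] (i < L × p (f i) ≡ false)
  go f (suc L) eq with p (f 0) in pf₀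
  ... | false = 0 , s≤s z≤n , pf₀
  ... | true  = let i , i<L , pfi = go (f ∘ suc) L eq in suc i , s≤s i<L , pfi

takeWhileᵇ-applyUpTo : ∀ {A : Set} (p : A → Bool) (g : ℕ → A) {k N} → k ≤ N →
                       (∀ j → j < k → p (g j) ≡ true) → (k < N → p (g k) ≡ false) →
                       takeWhileᵇ p (applyUpTo g N) ≡ applyUpTo g k
takeWhileᵇ-applyUpTo p g {zero}  {zero}  _ _ _ = refl
takeWhileᵇ-applyUpTo p g {zero}  {suc N} _ _ stop rewrite stop (s≤s z≤n) = refl
takeWhileᵇ-applyUpTo p g {suc k} {suc N} (s≤s k≤N) go stop rewrite go 0 (s≤s z≤n) =
  cong (g 0 ∷_) (takeWhileᵇ-applyUpTo p (g ∘ suc) k≤N (λ j j<k → go (suc j) (s≤s j<k)) (stop ∘ s≤s))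

last-true : (q : ℕ → Bool) → q 0 ≡ true → ∀ a →
            ∃[ t ] (t ≤ a × q t ≡ true × (∀ t′ → t < t′ → t′ ≤ a → q t′ ≡ false))
last-true q q₀ zero = 0 , z≤n , q₀ , λ t′ 0<t′ t′≤0 → ⊥-elim (<⇒≱ 0<t′ t′≤0)
last-true q q₀ (suc a) with q (suc a) in q-last
... | true  = suc a , ≤-refl , q-last , λ t′ a<t′ t′≤a → ⊥-elim (<⇒≱ a<t′ t′≤a)
... | false with last-true q q₀ a
... | t , t≤a , qt , later = t , m≤n⇒m≤1+n t≤a , qt , later′
  where
  later′ : ∀ t′ → t < t′ → t′ ≤ suc a → q t′ ≡ false
  later′ t′ t<t′ t′≤1+a with m≤n⇒m<n∨m≡n t′≤1+a
  ... | inj₁ t′<1+a = later t′ t<t′ (≤-pred t′<1+a)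
  ... | inj₂ refl   = q-last

-- Counting with Iverson brackets

[_] : Bool → ℕ
[ true ]  = 1
[ false ] = 0

[∧] : ∀ a b → [ a ] * [ b ] ≡ [ a ∧ b ]
[∧] true  b = +-identityʳ [ b ]
[∧] false b = refl

[]-split : ∀ a b → [ a ] ≡ [ a ∧ b ] + [ a ∧ not b ]
[]-split true  true  = refl
[]-split true  false = refl
[]-split false b     = refl

count : ∀ {n} → (Fin n → Bool) → ℕ
count {n} p = ∑[ d < n ] [ p d ]

countᵇ-tabulate : ∀ {A : Set} {n} (p : A → Bool) (f : Fin n → A) →
                  countᵇ p (tabulate f) ≡ ∑[ i < n ] [ p (f i) ]
countᵇ-tabulate {n = zero}  p f = refl
countᵇ-tabulate {n = suc n} p f with p (f fz)
... | true  = cong suc (countᵇ-tabulate p (f ∘ fs))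
... | false = countᵇ-tabulate p (f ∘ fs)

countᵇ-allFin : ∀ {n} (p : Fin n → Bool) → countᵇ p (allFin n) ≡ count p
countᵇ-allFin p = countᵇ-tabulate p (λ d → d)

countᵇ-applyUpTo : ∀ {A : Set} (p : A → Bool) (f : ℕ → A) L →
                   countᵇ p (applyUpTo f L) ≡ ∑[ i < L ] [ p (f (toℕ i)) ]
countᵇ-applyUpTo p f zero = refl
countᵇ-applyUpTo p f (suc L) with p (f 0)
... | true  = cong suc (countᵇ-applyUpTo p (f ∘ suc) L)
... | false = countᵇ-applyUpTo p (f ∘ suc) L

sumᴸ-map-upTo : ∀ (h : ℕ → ℕ) L → sumᴸ (map h (upTo L)) ≡ ∑[ i < L ] h (toℕ i)
sumᴸ-map-upTo h L = trans (cong sumᴸ (map-upTo h L)) (go h L)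
  where
  go : ∀ (h : ℕ → ℕ) L → sumᴸ (applyUpTo h L) ≡ ∑[ i < L ] h (toℕ i)
  go h zero    = refl
  go h (suc L) = cong (h 0 +_) (go (h ∘ suc) L)

count-cong : ∀ {n} {p q : Fin n → Bool} → (∀ d → p d ≡ q d) → count p ≡ count q
count-cong {n} p≗q = sum-cong-≗ {n} (cong [_] ∘ p≗q)

count-split : ∀ {n} (p q : Fin n → Bool) →
              count p ≡ count (λ d → p d ∧ q d) + count (λ d → p d ∧ not (q d))
count-split {n} p q = trans (sum-cong-≗ {n} (λ d → []-split (p d) (q d))) (∑-distrib-+ {n} _ _)

∑-1 : ∀ L → ∑[ i < L ] 1 ≡ L
∑-1 zero    = refl
∑-1 (suc L) = cong suc (∑-1 L)

sum-δ : ∀ {n} (x : Fin n) (g : Fin n → ℕ) → ∑[ d < n ] ([ x == d ] * g d) ≡ g x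
sum-δ {suc n} fz     g = trans (cong (g fz + 0 +_) (sum-replicate-zero n)) (trans (+-identityʳ _) (+-identityʳ _))
sum-δ {suc n} (fs x) g = trans (sum-cong-≗ {n} shift) (sum-δ x (g ∘ fs))
  where
  shift : ∀ d → [ fs x == fs d ] * g (fs d) ≡ [ x == d ] * g (fs d)
  shift d with x ≟ d
  ... | yes _ = refl
  ... | no  _ = refl

sum-reindex : ∀ {m n} (x : Fin m → Fin n) (g : Fin n → ℕ) →
              ∑[ i < m ] g (x i) ≡ ∑[ d < n ] (∑[ i < m ] [ x i == d ] * g d)
sum-reindex {m} {n} x g = begin
  ∑[ i < m ] g (x i)                            ≡⟨ sum-cong-≗ {m} (λ i → sum-δ (x i) g) ⟨
  ∑[ i < m ] ∑[ d < n ] ([ x i == d ] * g d)    ≡⟨ ∑-comm {m} {n} _ ⟩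
  ∑[ d < n ] ∑[ i < m ] ([ x i == d ] * g d)    ≡⟨ sum-cong-≗ {n} (λ d → *-distribʳ-sum {m} (g d) _) ⟨
  ∑[ d < n ] (∑[ i < m ] [ x i == d ] * g d)    ∎
  where open ≡-Reasoning

count-unique : ∀ {m} (c : Fin m → Bool) (b : Bool) →
               (∀ i j → c i ≡ true → c j ≡ true → i ≡ j) →
               (b ≡ true → ∃[ i ] c i ≡ true) → (∀ i → c i ≡ true → b ≡ true) →
               count c ≡ [ b ]
count-unique {m} c true  unique witness _ with witness refl
... | i₀ , ci₀ = trans (sum-cong-≗ {m} at) (sum-δ i₀ (λ _ → 1))
  where
  at : ∀ i → [ c i ] ≡ [ i₀ == i ] * 1
  at i with c i in ci | i₀ ≟ i
  ... | true  | yes _   = refl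
  ... | true  | no i₀≢i = ⊥-elim (i₀≢i (unique i₀ i ci₀ ci))
  ... | false | yes refl = ⊥-elim (true≢false (trans (sym ci₀) ci))
  ... | false | no _    = refl
count-unique {m} c false _ _ sound = trans (sum-cong-≗ {m} at) (sum-replicate-zero m)
  where
  at : ∀ i → [ c i ] ≡ 0
  at i with c i in ci
  ... | true  = ⊥-elim (true≢false (sym (sound i ci)))
  ... | false = refl

count-unique< : ∀ (c : ℕ → Bool) L (b : Bool) →
                (∀ i j → i < L → j < L → c i ≡ true → c j ≡ true → i ≡ j) →
                (b ≡ true → ∃[ i ] (i < L × c i ≡ true)) → (∀ i → i < L → c i ≡ true → b ≡ true) →
                ∑[ i < L ] [ c (toℕ i) ] ≡ [ b ]
count-unique< c L b unique witness sound = count-unique (c ∘ toℕ) b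
  (λ i j ci cj → toℕ-injective (unique _ _ (toℕ<n i) (toℕ<n j) ci cj))
  (λ b≡true → let i , i<L , ci = witness b≡true
              in  fromℕ< i<L , subst (λ k → c k ≡ true) (sym (toℕ-fromℕ< i<L)) ci)
  (λ i → sound (toℕ i) (toℕ<n i))

sum-∘-involution : ∀ {n} (α : Fin n → Fin n) → (∀ d → α (α d) ≡ d) → (g : Fin n → ℕ) →
                   ∑[ d < n ] g (α d) ≡ ∑[ d < n ] g d
sum-∘-involution α invol g = sym (sum-permute g (permutation α α invol invol))

count-involution : ∀ {n} (α : Fin n → Fin n) → (∀ d → α (α d) ≡ d) → (∀ d → ¬ α d ≡ d) →
                   (Q : Fin n → Bool) → (∀ d → Q (α d) ≡ Q d) →
                   count Q ≡ 2 * count (λ d → Q d ∧ (suc (toℕ d) ≤ᵇ toℕ (α d)))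
count-involution {n} α invol no-fix Q Q-α = begin
  count Q                                      ≡⟨ sum-cong-≗ {n} split ⟩
  ∑[ d < n ] (G d + G (α d))                   ≡⟨ ∑-distrib-+ {n} G (G ∘ α) ⟩
  ∑[ d < n ] G d + ∑[ d < n ] G (α d)          ≡⟨ cong (∑[ d < n ] G d +_) (sum-∘-involution α invol G) ⟩
  ∑[ d < n ] G d + ∑[ d < n ] G d              ≡⟨ cong (∑[ d < n ] G d +_) (+-identityʳ _) ⟨
  2 * ∑[ d < n ] G d                           ∎
  where
  open ≡-Reasoning
  G : Fin n → ℕ
  G d = [ Q d ∧ (suc (toℕ d) ≤ᵇ toℕ (α d)) ]
  one-of : ∀ a b → ¬ a ≡ b → [ suc a ≤ᵇ b ] + [ suc b ≤ᵇ a ] ≡ 1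
  one-of a b a≢b with suc a ≤ᵇ b | ≤ᵇ-reflects-≤ (suc a) b | suc b ≤ᵇ a | ≤ᵇ-reflects-≤ (suc b) a
  ... | true  | ofʸ a<b | true  | ofʸ b<a = ⊥-elim (<-asym a<b b<a)
  ... | true  | _       | false | _       = refl
  ... | false | _       | true  | _       = refl
  ... | false | ofⁿ a≮b | false | ofⁿ b≮a = ⊥-elim (a≢b (≤-antisym (≮⇒≥ b≮a) (≮⇒≥ a≮b)))
  split : ∀ d → [ Q d ] ≡ G d + G (α d)
  split d rewrite Q-α d | invol d with Q d
  ... | true  = sym (one-of (toℕ d) (toℕ (α d)) (λ eq → no-fix d (sym (toℕ-injective eq))))
  ... | false = refl

-- Iterates and orbits of a permutation

iter-+ : ∀ {A : Set} (f : A → A) a b x → iter f (a + b) x ≡ iter f a (iter f b x)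
iter-+ f zero    b x = refl
iter-+ f (suc a) b x = cong f (iter-+ f a b x)

iter-∸ : ∀ {A : Set} (f : A → A) {i j} → i ≤ j → ∀ x → iter f (j ∸ i) (iter f i x) ≡ iter f j x
iter-∸ f {i} {j} i≤j x = trans (sym (iter-+ f (j ∸ i) i x)) (cong (λ k → iter f k x) (m∸n+n≡m i≤j))

iter-split : ∀ {A : Set} (f : A → A) {i j} → i ≤ j → ∀ x → iter f j x ≡ iter f i (iter f (j ∸ i) x)
iter-split f {i} {j} i≤j x = trans (cong (λ k → iter f k x) (sym (m+[n∸m]≡n i≤j))) (iter-+ f i (j ∸ i) x)

iter-* : ∀ {A : Set} (f : A → A) {p x} → iter f p x ≡ x → ∀ q → iter f (q * p) x ≡ x
iter-* f fp≡x zero    = refl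
iter-* f {p} {x} fp≡x (suc q) = trans (iter-+ f p (q * p) x) (trans (cong (iter f p) (iter-* f fp≡x q)) fp≡x)

iter-% : ∀ {A : Set} (f : A → A) {p x} .{{_ : NonZero p}} → iter f p x ≡ x →
         ∀ j → iter f (j % p) x ≡ iter f j x
iter-% f {p} {x} fp≡x j = begin
  iter f (j % p) x                            ≡⟨ cong (iter f (j % p)) (sym (iter-* f fp≡x (j / p))) ⟩
  iter f (j % p) (iter f (j / p * p) x)       ≡⟨ sym (iter-+ f (j % p) (j / p * p) x) ⟩
  iter f (j % p + j / p * p) x                ≡⟨ cong (λ k → iter f k x) (sym (m≡m%n+[m/n]*n j p)) ⟩
  iter f j x                                  ∎
  where open ≡-Reasoning

module Orbits (M : Map) (f : Fin (Map.n M) → Fin (Map.n M)) (f-inj : Injective _≡_ _≡_ f) where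
  open Map M using (n)

  iter-injective : ∀ j {x y} → iter f j x ≡ iter f j y → x ≡ y
  iter-injective zero    eq = eq
  iter-injective (suc j) eq = iter-injective j (f-inj eq)

  period : ∀ d → ∃[ p ] (0 < p × p ≤ n × iter f p d ≡ d)
  period d with pigeonhole (n<1+n n) (λ (i : Fin (suc n)) → iter f (toℕ i) d)
  ... | i , j , i<j , fi≡fj =
    toℕ j ∸ toℕ i , m<n⇒0<n∸m i<j , ≤-trans (m∸n≤m (toℕ j) (toℕ i)) (≤-pred (toℕ<n j)) ,
    iter-injective (toℕ i) (begin
      iter f (toℕ i) (iter f (toℕ j ∸ toℕ i) d)   ≡⟨ sym (iter-+ f (toℕ i) _ d) ⟩
      iter f (toℕ i + (toℕ j ∸ toℕ i)) d         ≡⟨ cong (λ k → iter f k d) (m+[n∸m]≡n (<⇒≤ i<j)) ⟩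
      iter f (toℕ j) d                           ≡⟨ sym fi≡fj ⟩
      iter f (toℕ i) d                           ∎)
    where open ≡-Reasoning

  infix 4 _↝_
  _↝_ : Fin n → Fin n → Set
  d ↝ e = ∃[ j ] iter f j d ≡ e

  ↝-refl : ∀ {d} → d ↝ d
  ↝-refl = 0 , refl

  ↝-step : ∀ d → d ↝ f d
  ↝-step d = 1 , refl

  ↝-trans : ∀ {a b c} → a ↝ b → b ↝ c → a ↝ c
  ↝-trans {a} (i , fi≡b) (j , fj≡c) = j + i , trans (iter-+ f j i a) (trans (cong (iter f j) fi≡b) fj≡c)

  ↝-bounded : ∀ {d e} → d ↝ e → ∃[ j ] (j < n × iter f j d ≡ e)
  ↝-bounded {d} (j , fj≡e) with period d
  ... | p , p>0 , p≤n , fp≡d = j % p , <-≤-trans (m%n<n j p) p≤n , trans (iter-% f fp≡d j) fj≡e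
    where instance _ = >-nonZero p>0

  ↝-sym : ∀ {d e} → d ↝ e → e ↝ d
  ↝-sym {d} {e} (j , fj≡e) with period d
  ... | p , p>0 , _ , fp≡d = p ∸ j % p , (begin
    iter f (p ∸ j % p) e                     ≡⟨ cong (iter f (p ∸ j % p)) (sym (trans (iter-% f fp≡d j) fj≡e)) ⟩
    iter f (p ∸ j % p) (iter f (j % p) d)    ≡⟨ sym (iter-+ f (p ∸ j % p) (j % p) d) ⟩
    iter f (p ∸ j % p + j % p) d             ≡⟨ cong (λ k → iter f k d) (m∸n+n≡m (<⇒≤ (m%n<n j p))) ⟩
    iter f p d                               ≡⟨ fp≡d ⟩
    d                                        ∎)
    where
    open ≡-Reasoning
    instance _ = >-nonZero p>0

  inOrbit⇒↝ : ∀ {d e} → inOrbit M f d e ≡ true → d ↝ e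
  inOrbit⇒↝ {d} {e} eq = let j , _ , fj==e = any-upTo⁻ (λ j → iter f j d == e) n eq in j , ==⇒≡ fj==e

  ↝⇒inOrbit : ∀ {d e} → d ↝ e → inOrbit M f d e ≡ true
  ↝⇒inOrbit {d} {e} d↝e =
    let j , j<n , fj≡e = ↝-bounded d↝e in any-upTo⁺ (λ j → iter f j d == e) n j<n (≡⇒== fj≡e)

  isRep⇒minimal : ∀ {r e} → isRep M f r ≡ true → r ↝ e → toℕ r ≤ toℕ e
  isRep⇒minimal {r} isRep-r r↝e with ↝-bounded r↝e
  ... | j , j<n , refl =
    ≤ᵇ⇒≤ (toℕ r) _ (Equivalence.from T-≡ (all-upTo⁻ (λ j → toℕ r ≤ᵇ toℕ (iter f j r)) n isRep-r j<n))

  ¬isRep⇒smaller : ∀ {r} → isRep M f r ≡ false → ∃[ j ] (toℕ (iter f j r) < toℕ r)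
  ¬isRep⇒smaller {r} ¬isRep-r with all-upTo-false (λ j → toℕ r ≤ᵇ toℕ (iter f j r)) n ¬isRep-r
  ... | j , _ , r≰fj = j , ≰⇒> (λ r≤fj → subst T r≰fj (≤⇒≤ᵇ r≤fj))

  rep-exists : ∀ e → ∃[ r ] (isRep M f r ≡ true × r ↝ e)
  rep-exists e = descend (suc (toℕ e)) e ≤-refl ↝-refl
    where
    descend : ∀ b x → toℕ x < b → x ↝ e → ∃[ r ] (isRep M f r ≡ true × r ↝ e)
    descend (suc b) x (s≤s x≤b) x↝e with isRep M f x in isRep-x
    ... | true  = x , isRep-x , x↝e
    ... | false = let j , smaller = ¬isRep⇒smaller isRep-x
                  in  descend b (iter f j x) (≤-trans smaller x≤b) (↝-trans (↝-sym (j , refl)) x↝e)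

  rep-unique : ∀ {r₁ r₂ e} → isRep M f r₁ ≡ true → isRep M f r₂ ≡ true → r₁ ↝ e → r₂ ↝ e → r₁ ≡ r₂
  rep-unique isRep₁ isRep₂ r₁↝e r₂↝e = toℕ-injective (≤-antisym
    (isRep⇒minimal isRep₁ (↝-trans r₁↝e (↝-sym r₂↝e)))
    (isRep⇒minimal isRep₂ (↝-trans r₂↝e (↝-sym r₁↝e))))

  Closed : (Fin n → Bool) → Set
  Closed P = ∀ d → P d ≡ true → P (f d) ≡ true

  ↝-preserves : ∀ {P} → Closed P → ∀ {d e} → d ↝ e → P d ≡ true → P e ≡ true
  ↝-preserves P-closed (zero  , refl) Pd = Pd
  ↝-preserves P-closed (suc j , refl) Pd = P-closed _ (↝-preserves P-closed (j , refl) Pd)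

  ↝-constant : ∀ {P} → Closed P → ∀ {d e} → d ↝ e → P d ≡ P e
  ↝-constant P-closed d↝e =
    ⇔→≡ {z = true} (mk⇔ (↝-preserves P-closed d↝e) (↝-preserves P-closed (↝-sym d↝e)))

  count-reps-of : ∀ {P} → Closed P → ∀ e → count (λ r → (P r ∧ isRep M f r) ∧ inOrbit M f r e) ≡ [ P e ]
  count-reps-of {P} P-closed e = count-unique _ (P e) unique witness sound
    where
    IsRepOf : Fin n → Bool
    IsRepOf r = (P r ∧ isRep M f r) ∧ inOrbit M f r e
    unpack : ∀ r → IsRepOf r ≡ true → P r ≡ true × isRep M f r ≡ true × r ↝ e
    unpack r c = let rep , r∈orbit = ∧-true⁻ (P r ∧ isRep M f r) c
                     Pr , isRep-r   = ∧-true⁻ (P r) rep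
                 in  Pr , isRep-r , inOrbit⇒↝ r∈orbit
    unique : ∀ r₁ r₂ → IsRepOf r₁ ≡ true → IsRepOf r₂ ≡ true → r₁ ≡ r₂
    unique r₁ r₂ c₁ c₂ = let _ , isRep₁ , r₁↝e = unpack r₁ c₁
                             _ , isRep₂ , r₂↝e = unpack r₂ c₂
                         in  rep-unique isRep₁ isRep₂ r₁↝e r₂↝e
    witness : P e ≡ true → ∃[ r ] (IsRepOf r ≡ true)
    witness Pe = let r , isRep-r , r↝e = rep-exists e in
      r , cong₂ _∧_ (cong₂ _∧_ (trans (↝-constant P-closed r↝e) Pe) isRep-r) (↝⇒inOrbit r↝e)
    sound : ∀ r → IsRepOf r ≡ true → P e ≡ true
    sound r c = let Pr , _ , r↝e = unpack r c in ↝-preserves P-closed r↝e Pr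

  count-orbits : ∀ {P} → Closed P → (q : Fin n → Bool) (c : ℕ) →
                 (∀ r → count (λ e → inOrbit M f r e ∧ q e) ≡ c) →
                 count (λ e → P e ∧ q e) ≡ c * count (λ r → P r ∧ isRep M f r)
  count-orbits {P} P-closed q c orbit-count = sym (begin
    c * ∑[ r < n ] [ rep r ]
      ≡⟨ *-distribˡ-sum {n} c _ ⟩
    ∑[ r < n ] (c * [ rep r ])
      ≡⟨ sum-cong-≗ {n} (λ r → trans (*-comm c _) (cong ([ rep r ] *_) (sym (orbit-count r)))) ⟩
    ∑[ r < n ] ([ rep r ] * ∑[ e < n ] [ inOrbit M f r e ∧ q e ])
      ≡⟨ sum-cong-≗ {n} (λ r → *-distribˡ-sum {n} [ rep r ] _) ⟩
    ∑[ r < n ] ∑[ e < n ] ([ rep r ] * [ inOrbit M f r e ∧ q e ])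
      ≡⟨ ∑-comm {n} {n} _ ⟩
    ∑[ e < n ] ∑[ r < n ] ([ rep r ] * [ inOrbit M f r e ∧ q e ])
      ≡⟨ sum-cong-≗ {n} (λ e → sum-cong-≗ {n} (regroup e)) ⟩
    ∑[ e < n ] ∑[ r < n ] ([ q e ] * [ rep r ∧ inOrbit M f r e ])
      ≡⟨ sum-cong-≗ {n} (λ e → sym (*-distribˡ-sum {n} [ q e ] _)) ⟩
    ∑[ e < n ] ([ q e ] * count (λ r → rep r ∧ inOrbit M f r e))
      ≡⟨ sum-cong-≗ {n} (λ e → cong ([ q e ] *_) (count-reps-of P-closed e)) ⟩
    ∑[ e < n ] ([ q e ] * [ P e ])
      ≡⟨ sum-cong-≗ {n} (λ e → trans ([∧] (q e) (P e)) (cong [_] (∧-comm (q e) (P e)))) ⟩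
    count (λ e → P e ∧ q e) ∎)
    where
    open ≡-Reasoning
    rep : Fin n → Bool
    rep r = P r ∧ isRep M f r
    regroup : ∀ e r → [ rep r ] * [ inOrbit M f r e ∧ q e ] ≡ [ q e ] * [ rep r ∧ inOrbit M f r e ]
    regroup e r = begin
      [ rep r ] * [ inOrbit M f r e ∧ q e ]   ≡⟨ [∧] (rep r) (inOrbit M f r e ∧ q e) ⟩
      [ rep r ∧ (inOrbit M f r e ∧ q e) ]     ≡⟨ cong [_] (x∙yz≈z∙xy (rep r) (inOrbit M f r e) (q e)) ⟩
      [ q e ∧ (rep r ∧ inOrbit M f r e) ]     ≡⟨ [∧] (q e) (rep r ∧ inOrbit M f r e) ⟨
      [ q e ] * [ rep r ∧ inOrbit M f r e ]   ∎

module _ (M : Map) where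
  open Map M

  α-injective : Injective _≡_ _≡_ α
  α-injective {x} {y} αx≡αy = trans (sym (α-invol x)) (trans (cong α αx≡αy) (α-invol y))

  φ-injective : Injective _≡_ _≡_ (φ M)
  φ-injective = α-injective ∘ σ-inj

  module σ-Orbits = Orbits M σ σ-inj
  module φ-Orbits = Orbits M (φ M) φ-injective

  module _ (quad : Quadrangulation M) where

    no-short-face : ∀ x t → 0 < t → t < 4 → ¬ iter (φ M) t x ≡ x
    no-short-face x 1 _ _ = proj₁ (proj₂ (quad x))
    no-short-face x 2 _ _ = proj₂ (proj₂ (quad x))
    no-short-face x 3 _ _ φ³x≡x = proj₁ (proj₂ (quad x)) (trans (cong (φ M) (sym φ³x≡x)) (proj₁ (quad x)))
    no-short-face x (suc (suc (suc (suc _)))) _ (s≤s (s≤s (s≤s (s≤s ()))))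

    face-iterates-< : ∀ r {i j} → i < j → j < 4 → ¬ iter (φ M) i r ≡ iter (φ M) j r
    face-iterates-< r {i} {j} i<j j<4 eq = no-short-face (iter (φ M) i r) (j ∸ i) (m<n⇒0<n∸m i<j)
      (≤-<-trans (m∸n≤m j i) j<4) (trans (iter-∸ (φ M) (<⇒≤ i<j) r) (sym eq))

    face-iterates-distinct : ∀ r i j → i < 4 → j < 4 → iter (φ M) i r ≡ iter (φ M) j r → i ≡ j
    face-iterates-distinct r i j i<4 j<4 eq with <-cmp i j
    ... | tri< i<j _ _ = ⊥-elim (face-iterates-< r i<j j<4 eq)
    ... | tri≈ _ i≡j _ = i≡j
    ... | tri> _ _ j<i = ⊥-elim (face-iterates-< r j<i i<4 (sym eq))

    face-size : ∀ r → count (λ e → inOrbit M (φ M) r e ∧ true) ≡ 4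
    face-size r = begin
      count (λ e → inOrbit M (φ M) r e ∧ true)
        ≡⟨ sum-cong-≗ {n} (λ e → sym (*-identityʳ _)) ⟩
      ∑[ e < n ] ([ inOrbit M (φ M) r e ∧ true ] * 1)
        ≡⟨ sum-cong-≗ {n} (λ e → cong (_* 1) (sym (iterates e))) ⟩
      ∑[ e < n ] (∑[ j < 4 ] [ iter (φ M) (toℕ j) r == e ] * 1)
        ≡⟨ sum-reindex {4} {n} (λ j → iter (φ M) (toℕ j) r) (λ _ → 1) ⟨
      ∑[ j < 4 ] 1 ∎
      where
      open ≡-Reasoning
      iterates : ∀ e → ∑[ j < 4 ] [ iter (φ M) (toℕ j) r == e ] ≡ [ inOrbit M (φ M) r e ∧ true ]
      iterates e = count-unique< (λ j → iter (φ M) j r == e) 4 _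
        (λ i j i<4 j<4 φⁱr≡e φʲr≡e →
          face-iterates-distinct r i j i<4 j<4 (trans (==⇒≡ φⁱr≡e) (sym (==⇒≡ φʲr≡e))))
        witness
        (λ j _ φʲr≡e → cong (_∧ true) (φ-Orbits.↝⇒inOrbit (j , ==⇒≡ φʲr≡e)))
        where
        witness : inOrbit M (φ M) r e ∧ true ≡ true → ∃[ j ] (j < 4 × (iter (φ M) j r == e) ≡ true)
        witness r↝e with φ-Orbits.inOrbit⇒↝ (trans (sym (∧-identityʳ _)) r↝e)
        ... | j , φʲr≡e = j % 4 , m%n<n j 4 , ≡⇒== (trans (iter-% (φ M) (proj₁ (quad r)) j) φʲr≡e)

-- The disk enclosed by a closed walk

module Walk (M : Map) (L : ℕ) (W : ℕ → Fin (Map.n M)) (R : Fin (Map.n M) → Bool)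
            (disk : EnclosesDisk M L W R) where
  open Map M
  open EnclosesDisk disk
  open σ-Orbits M using (_↝_; ↝-sym; ↝-trans; ↝-step; ↝⇒inOrbit; inOrbit⇒↝)

  traversed : Fin n → Bool
  traversed = onW M L W

  visits : Fin n → Bool
  visits = visited M L W

  walk-injective : ∀ {i j} → i < L → j < L → W i ≡ W j → i ≡ j
  walk-injective {i} {j} i<L j<L Wi≡Wj with <-cmp i j
  ... | tri< i<j _ _ = ⊥-elim (distinct i j i<j j<L Wi≡Wj)
  ... | tri≈ _ i≡j _ = i≡j
  ... | tri> _ _ j<i = ⊥-elim (distinct j i j<i i<L (sym Wi≡Wj))

  walk-index : ∀ {j} → j ≤ L → ∃[ i ] (i < L × W i ≡ W j)
  walk-index {j} j≤L with m≤n⇒m<n∨m≡n j≤L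
  ... | inj₁ j<L = j , j<L , refl
  ... | inj₂ refl = 0 , nonempty , sym closed

  traversed-α : ∀ d → traversed (α d) ≡ traversed d
  traversed-α d = cong or (map-cong swap (upTo L))
    where
    swap : ∀ i → ((W i == α d) ∨ (W i == α (α d))) ≡ ((W i == d) ∨ (W i == α d))
    swap i rewrite α-invol d = ∨-comm (W i == α d) (W i == d)

  traversed⁻ : ∀ {d} → traversed d ≡ true → ∃[ i ] (i < L × (W i ≡ d ⊎ W i ≡ α d))
  traversed⁻ {d} eq with any-upTo⁻ (λ i → (W i == d) ∨ (W i == α d)) L eq
  ... | i , i<L , Wi≡d∨Wi≡αd with W i == d in Wi≡d
  ... | true  = i , i<L , inj₁ (==⇒≡ Wi≡d)
  ... | false = i , i<L , inj₂ (==⇒≡ Wi≡d∨Wi≡αd)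

  traversed-W : ∀ {j} → j ≤ L → traversed (W j) ≡ true
  traversed-W {j} j≤L with walk-index j≤L
  ... | i , i<L , Wi≡Wj = any-upTo⁺ (λ k → (W k == W j) ∨ (W k == α (W j))) L i<L
                            (cong (_∨ (W i == α (W j))) (≡⇒== Wi≡Wj))

  visits⁻ : ∀ {d} → visits d ≡ true → ∃[ i ] (i < L × W i ↝ d)
  visits⁻ {d} eq =
    let i , i<L , Wi∼d = any-upTo⁻ (λ i → sameVertex M (W i) d) L eq in i , i<L , inOrbit⇒↝ Wi∼d

  visits⁺ : ∀ {j d} → j ≤ L → W j ↝ d → visits d ≡ true
  visits⁺ {j} {d} j≤L Wj↝d with walk-index j≤L
  ... | i , i<L , Wi≡Wj =
    any-upTo⁺ (λ i → sameVertex M (W i) d) L i<L (↝⇒inOrbit (subst (_↝ d) (sym Wi≡Wj) Wj↝d))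

  arrival-↝ : ∀ {i} → i < L → α (W i) ↝ W (suc i)
  arrival-↝ i<L = let m , _ , Wi+1≡σᵐ , _ = step _ i<L in m , sym Wi+1≡σᵐ

  traversed⇒visits : ∀ {d} → traversed d ≡ true → visits d ≡ true
  traversed⇒visits {d} eq with traversed⁻ eq
  ... | i , i<L , inj₁ Wi≡d  = visits⁺ (<⇒≤ i<L) (0 , Wi≡d)
  ... | i , i<L , inj₂ Wi≡αd =
    visits⁺ i<L (↝-sym (subst (_↝ W (suc i)) (trans (cong α Wi≡αd) (α-invol d)) (arrival-↝ i<L)))

  unvisited⇒untraversed : ∀ {d} → visits d ≡ false → traversed d ≡ false
  unvisited⇒untraversed {d} unvisited with traversed d in eq
  ... | true  = trans (sym (traversed⇒visits eq)) unvisited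
  ... | false = refl

  visits-σ⁻ : ∀ {d} → visits (σ d) ≡ true → visits d ≡ true
  visits-σ⁻ eq = let i , i<L , Wi↝σd = visits⁻ eq in visits⁺ (<⇒≤ i<L) (↝-trans Wi↝σd (↝-sym (↝-step _)))

  R-φ : ∀ d → R (φ M d) ≡ R d
  R-φ d = sym (φ-Orbits.↝-constant M R-faces (φ-Orbits.↝-step M d))

  R-α : ∀ {d} → traversed d ≡ false → R (α d) ≡ R d
  R-α {d} untraversed = ⇔→≡ {z = true} (mk⇔ back (λ Rd → R-cross d Rd untraversed))
    where
    back : R (α d) ≡ true → R d ≡ true
    back Rαd = subst (λ e → R e ≡ true) (α-invol d) (R-cross (α d) Rαd (trans (traversed-α d) untraversed))

  R-σ : ∀ {d} → traversed d ≡ false → R (σ d) ≡ R d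
  R-σ {d} untraversed = begin
    R (σ d)            ≡⟨ cong (R ∘ σ) (α-invol d) ⟨
    R (φ M (α d))      ≡⟨ R-φ (α d) ⟩
    R (α d)            ≡⟨ R-α untraversed ⟩
    R d                ∎
    where open ≡-Reasoning

  R-fan : ∀ x s → 1 ≤ s → (∀ t → 1 ≤ t → t < s → traversed (iter σ t x) ≡ false) →
          R (iter σ s x) ≡ R (σ x)
  R-fan x (suc zero)    _ _           = refl
  R-fan x (suc (suc s)) _ untraversed =
    trans (R-σ (untraversed (suc s) (s≤s z≤n) ≤-refl))
          (R-fan x (suc s) (s≤s z≤n) (λ t 1≤t t<s → untraversed t 1≤t (m≤n⇒m≤1+n t<s)))

  boundary-indicator : ∀ d → ∑[ i < L ] [ W (toℕ i) == d ] ≡ [ R d ∧ traversed d ]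
  boundary-indicator d = count-unique< (λ i → W i == d) L (R d ∧ traversed d)
    (λ i j i<L j<L Wi≡d Wj≡d → walk-injective i<L j<L (trans (==⇒≡ Wi≡d) (sym (==⇒≡ Wj≡d))))
    witness
    (λ i i<L Wi≡d → subst (λ e → R e ∧ traversed e ≡ true) (==⇒≡ Wi≡d)
                      (cong₂ _∧_ (W-right i i<L) (traversed-W (<⇒≤ i<L))))
    where
    witness : R d ∧ traversed d ≡ true → ∃[ i ] (i < L × (W i == d) ≡ true)
    witness Rd∧traversed = let Rd , traversed-d = ∧-true⁻ (R d) Rd∧traversed
                               i , i<L , Wi≡d  = boundary d Rd traversed-d
                           in  i , i<L , ≡⇒== Wi≡d

  count-boundary : count (λ d → R d ∧ traversed d) ≡ L
  count-boundary = begin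
    count (λ d → R d ∧ traversed d)
      ≡⟨ sum-cong-≗ {n} (λ d → sym (*-identityʳ _)) ⟩
    ∑[ d < n ] ([ R d ∧ traversed d ] * 1)
      ≡⟨ sum-cong-≗ {n} (λ d → cong (_* 1) (boundary-indicator d)) ⟨
    ∑[ d < n ] (∑[ i < L ] [ W (toℕ i) == d ] * 1)
      ≡⟨ sum-reindex {L} {n} (W ∘ toℕ) (λ _ → 1) ⟨
    ∑[ i < L ] 1
      ≡⟨ ∑-1 L ⟩
    L ∎
    where open ≡-Reasoning

  cw-count : ∀ out → cw M out L W ≡ count (λ d → (R d ∧ traversed d) ∧ out d)
  cw-count out = begin
    cw M out L W
      ≡⟨ countᵇ-applyUpTo (out ∘ W) (λ i → i) L ⟩
    ∑[ i < L ] [ out (W (toℕ i)) ]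
      ≡⟨ sum-reindex {L} {n} (W ∘ toℕ) (λ d → [ out d ]) ⟩
    ∑[ d < n ] (∑[ i < L ] [ W (toℕ i) == d ] * [ out d ])
      ≡⟨ sum-cong-≗ {n} (λ d → cong (_* [ out d ]) (boundary-indicator d)) ⟩
    ∑[ d < n ] ([ R d ∧ traversed d ] * [ out d ])
      ≡⟨ sum-cong-≗ {n} (λ d → [∧] (R d ∧ traversed d) (out d)) ⟩
    count (λ d → (R d ∧ traversed d) ∧ out d) ∎
    where open ≡-Reasoning

  interior : Fin n → Bool
  interior d = R d ∧ not (traversed d)

  interior-α : ∀ d → interior (α d) ≡ interior d
  interior-α d rewrite traversed-α d with traversed d in untraversed
  ... | true  = trans (∧-zeroʳ (R (α d))) (sym (∧-zeroʳ (R d)))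
  ... | false = cong (_∧ true) (R-α untraversed)

  count-interior : count interior ≡ 2 * #Eint M L W R
  count-interior = begin
    count interior
      ≡⟨ count-involution α α-invol α-nofix interior interior-α ⟩
    2 * count (λ d → interior d ∧ (suc (toℕ d) ≤ᵇ toℕ (α d)))
      ≡⟨ cong (2 *_) (count-cong {n} both-sides) ⟩
    2 * count (λ d → R d ∧ R (α d) ∧ not (traversed d) ∧ (suc (toℕ d) ≤ᵇ toℕ (α d)))
                                                                     ≡⟨ cong (2 *_) (countᵇ-allFin {n} _) ⟨
    2 * #Eint M L W R ∎
    where
    open ≡-Reasoning
    both-sides : ∀ d → interior d ∧ (suc (toℕ d) ≤ᵇ toℕ (α d))
                     ≡ R d ∧ R (α d) ∧ not (traversed d) ∧ (suc (toℕ d) ≤ᵇ toℕ (α d))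
    both-sides d with R d in Rd | traversed d in untraversed
    ... | false | _     = refl
    ... | true  | true  = sym (∧-zeroʳ (R (α d)))
    ... | true  | false rewrite R-α untraversed | Rd = refl

  count-region : Quadrangulation M → count R ≡ 4 * #Fint M L W R
  count-region quad = begin
    count R                                    ≡⟨ count-cong {n} (λ d → sym (∧-identityʳ (R d))) ⟩
    count (λ d → R d ∧ true)                   ≡⟨ φ-Orbits.count-orbits M R-faces (λ _ → true) 4 (face-size M quad) ⟩
    4 * count (λ r → R r ∧ isRep M (φ M) r)    ≡⟨ cong (4 *_) (countᵇ-allFin {n} _) ⟨
    4 * #Fint M L W R                          ∎
    where open ≡-Reasoning

  #Fint-ingoing : ∀ {out} → Biorientation M out → SQuad M out → #Fint M L W R ≡ count (λ d → R d ∧ not (out d))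
  #Fint-ingoing {out} bio squad = begin
    #Fint M L W R
      ≡⟨ countᵇ-allFin {n} _ ⟩
    count (λ r → R r ∧ isRep M (φ M) r)
      ≡⟨ +-identityʳ _ ⟨
    1 * count (λ r → R r ∧ isRep M (φ M) r)
      ≡⟨ φ-Orbits.count-orbits M R-faces simply-directed 1 one-per-face ⟨
    count (λ d → R d ∧ simply-directed d)
      ≡⟨ count-cong {n} (λ d → cong (R d ∧_) (ingoing d)) ⟩
    count (λ d → R d ∧ not (out d)) ∎
    where
    open ≡-Reasoning
    simply-directed : Fin n → Bool
    simply-directed e = not (out e) ∧ out (α e)
    one-per-face : ∀ r → count (λ e → inOrbit M (φ M) r e ∧ simply-directed e) ≡ 1
    one-per-face r = trans (sym (countᵇ-allFin {n} _)) (squad r)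
    ingoing : ∀ e → simply-directed e ≡ not (out e)
    ingoing e with out e in out-e
    ... | true  = refl
    ... | false = subst (λ b → b ∨ out (α e) ≡ true) out-e (bio e)

  unvisited : Fin n → Bool
  unvisited d = R d ∧ not (visits d)

  unvisited-closed : σ-Orbits.Closed M unvisited
  unvisited-closed d eq with visits d in visits-d | visits (σ d) in visits-σd
  ... | true  | _     = ⊥-elim (true≢false (trans (sym eq) (∧-zeroʳ (R d))))
  ... | false | true  = ⊥-elim (true≢false (trans (sym (visits-σ⁻ visits-σd)) visits-d))
  ... | false | false =
    cong (_∧ true) (trans (R-σ (unvisited⇒untraversed visits-d)) (trans (sym (∧-identityʳ (R d))) eq))

  count-unvisited-out : ∀ {out} → ThreeBiorientation M out → count (λ d → unvisited d ∧ out d) ≡ 3 * #Vint M L W R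
  count-unvisited-out {out} (_ , three-out) = begin
    count (λ d → unvisited d ∧ out d)
      ≡⟨ σ-Orbits.count-orbits M unvisited-closed out 3 (λ r → trans (sym (countᵇ-allFin {n} _)) (three-out r)) ⟩
    3 * count (λ r → unvisited r ∧ isRep M σ r)
      ≡⟨ cong (3 *_) (count-cong {n} (λ r → xy∙z≈x∙zy (R r) (not (visits r)) (isRep M σ r))) ⟩
    3 * count (λ r → R r ∧ isRep M σ r ∧ not (visits r))
      ≡⟨ cong (3 *_) (countᵇ-allFin {n} _) ⟨
    3 * #Vint M L W R ∎
    where open ≡-Reasoning

  interior-unvisited : ∀ d → interior d ∧ not (visits d) ≡ unvisited d
  interior-unvisited d with visits d in visits-d
  ... | true  = trans (∧-zeroʳ (interior d)) (sym (∧-zeroʳ (R d)))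
  ... | false rewrite unvisited⇒untraversed visits-d = cong (_∧ true) (∧-identityʳ (R d))

-- Corners on the right of the walk

module Corners (M : Map) (L : ℕ) (W : ℕ → Fin (Map.n M)) (R : Fin (Map.n M) → Bool)
               (disk : EnclosesDisk M L W R) where
  open Map M
  open EnclosesDisk disk
  open Walk M L W R disk
  open σ-Orbits M using (↝-sym; ↝-trans; iter-injective; period)

  arrival : Fin L → Fin n
  arrival i = α (W (toℕ i))

  turns : Fin L → ℕ
  turns i = proj₁ (step (toℕ i) (toℕ<n i))

  turns-pos : ∀ i → 1 ≤ turns i
  turns-pos i = proj₁ (proj₂ (step (toℕ i) (toℕ<n i)))

  turns-next : ∀ i → iter σ (turns i) (arrival i) ≡ W (suc (toℕ i))
  turns-next i = sym (proj₁ (proj₂ (proj₂ (step (toℕ i) (toℕ<n i)))))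

  turns-untraversed : ∀ i t → 1 ≤ t → t < turns i → traversed (iter σ t (arrival i)) ≡ false
  turns-untraversed i = proj₂ (proj₂ (proj₂ (step (toℕ i) (toℕ<n i))))

  arrival-traversed : ∀ i → traversed (arrival i) ≡ true
  arrival-traversed i = trans (traversed-α _) (traversed-W (<⇒≤ (toℕ<n i)))

  next-traversed : ∀ i → traversed (W (suc (toℕ i))) ≡ true
  next-traversed i = traversed-W (toℕ<n i)

  turns≤n : ∀ i → turns i ≤ n
  turns≤n i with period (arrival i)
  ... | p , p>0 , p≤n , σᵖ≡id with p <? turns i
  ... | yes p<turns = ⊥-elim (true≢false (trans (sym (arrival-traversed i))
                        (trans (cong traversed (sym σᵖ≡id)) (turns-untraversed i p p>0 p<turns))))
  ... | no  p≮turns = ≤-trans (≮⇒≥ p≮turns) p≤n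

  -- The right corner of the i-th step consists of the darts σᵗ (arrival i) with 0 < t < turns i;
  -- corner i j is the one with t = suc j, as in rightCorner.
  corner : Fin L → ℕ → Fin n
  corner i j = iter σ (suc j) (arrival i)

  corner-interior : ∀ i j → suc j < turns i → interior (corner i j) ∧ visits (corner i j) ≡ true
  corner-interior i j j<turns =
    cong₂ _∧_ (cong₂ _∧_ in-region (cong not (turns-untraversed i (suc j) (s≤s z≤n) j<turns))) at-walk-vertex
    where
    in-region : R (corner i j) ≡ true
    in-region = trans (R-fan (arrival i) (suc j) (s≤s z≤n) (λ t 1≤t t<j → turns-untraversed i t 1≤t (<-trans t<j j<turns)))
                      (trans (R-φ (W (toℕ i))) (W-right (toℕ i) (toℕ<n i)))
    at-walk-vertex : visits (corner i j) ≡ true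
    at-walk-vertex = visits⁺ (toℕ<n i) (↝-trans (↝-sym (turns i , turns-next i)) (suc j , refl))

  turn-unique≤ : ∀ i i′ {a b} → a ≤ b → b < turns i′ →
                 iter σ a (arrival i) ≡ iter σ b (arrival i′) → i ≡ i′ × a ≡ b
  turn-unique≤ i i′ {a} {b} a≤b b<turns eq
    with b ∸ a in b∸a≡ | iter-injective a (trans eq (iter-split σ a≤b (arrival i′)))
  ... | zero  | arrival≡ = toℕ-injective (walk-injective (toℕ<n i) (toℕ<n i′) (α-injective M arrival≡)) ,
                           ≤-antisym a≤b (m∸n≡0⇒m≤n b∸a≡)
  ... | suc t | arrival≡ = ⊥-elim (true≢false (begin
    true
      ≡⟨ arrival-traversed i ⟨
    traversed (arrival i)
      ≡⟨ cong traversed arrival≡ ⟩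
    traversed (iter σ (suc t) (arrival i′))
      ≡⟨ turns-untraversed i′ (suc t) (s≤s z≤n) (subst (_< turns i′) b∸a≡ (≤-<-trans (m∸n≤m b a) b<turns)) ⟩
    false ∎))
    where open ≡-Reasoning

  turn-unique : ∀ i i′ {a b} → a < turns i → b < turns i′ →
                iter σ a (arrival i) ≡ iter σ b (arrival i′) → i ≡ i′ × a ≡ b
  turn-unique i i′ {a} {b} a<turns b<turns eq with ≤-total a b
  ... | inj₁ a≤b = turn-unique≤ i i′ a≤b b<turns eq
  ... | inj₂ b≤a = let i′≡i , b≡a = turn-unique≤ i′ i b≤a a<turns (sym eq) in sym i′≡i , sym b≡a

  cornerSize : Fin L → ℕ
  cornerSize i = turns i ∸ 1

  suc-cornerSize : ∀ i → suc (cornerSize i) ≡ turns i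
  suc-cornerSize i = m+[n∸m]≡n (turns-pos i)

  rightCorner-≡ : ∀ i → rightCorner M L W (toℕ i) ≡ applyUpTo (corner i) (cornerSize i)
  rightCorner-≡ i = trans (cong (takeWhileᵇ before-next) (map-upTo (corner i) n))
    (takeWhileᵇ-applyUpTo before-next (corner i) (≤-trans (m∸n≤m (turns i) 1) (turns≤n i)) inside at-end)
    where
    before-next : Fin n → Bool
    before-next x = not (x == W (suc (toℕ i)))
    inside : ∀ j → j < cornerSize i → before-next (corner i j) ≡ true
    inside j j<size = cong not (≢⇒== λ eq → true≢false (begin
      true
        ≡⟨ next-traversed i ⟨
      traversed (W (suc (toℕ i)))
        ≡⟨ cong traversed eq ⟨
      traversed (corner i j)
        ≡⟨ turns-untraversed i (suc j) (s≤s z≤n) (subst (suc j <_) (suc-cornerSize i) (s≤s j<size)) ⟩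
      false ∎))
      where open ≡-Reasoning
    at-end : cornerSize i < n → before-next (corner i (cornerSize i)) ≡ false
    at-end _ = cong not (≡⇒== (trans (cong (λ k → iter σ k (arrival i)) (suc-cornerSize i)) (turns-next i)))

  corner-index : ∀ i {j} → j < cornerSize i → suc j < turns i
  corner-index i j<size = subst (_ <_) (suc-cornerSize i) (s≤s j<size)

  arrival-of : ∀ {z} → traversed z ≡ true → R (σ z) ≡ true → ∃[ i ] (arrival i ≡ z)
  arrival-of {z} traversed-z Rσz with boundary (α z) Rαz (trans (traversed-α z) traversed-z)
    where
    Rαz : R (α z) ≡ true
    Rαz = trans (sym (R-φ (α z))) (trans (cong (R ∘ σ) (α-invol z)) Rσz)
  ... | i , i<L , Wi≡αz =
    fromℕ< i<L , trans (cong (α ∘ W) (toℕ-fromℕ< i<L)) (trans (cong α Wi≡αz) (α-invol z))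

  fan-in-corner : ∀ z s {d} → traversed z ≡ true → iter σ (suc s) z ≡ d → R d ≡ true →
                  (∀ t → 1 ≤ t → t ≤ suc s → traversed (iter σ t z) ≡ false) →
                  ∃[ i ] ∃[ j ] (j < cornerSize i × corner i j ≡ d)
  fan-in-corner z s {d} traversed-z σˢz≡d Rd untraversed with arrival-of traversed-z Rσz
    where
    Rσz : R (σ z) ≡ true
    Rσz = trans (sym (R-fan z (suc s) (s≤s z≤n) (λ t 1≤t t≤s → untraversed t 1≤t (<⇒≤ t≤s))))
                (trans (cong R σˢz≡d) Rd)
  ... | i , arrival≡z = i , s , s<size , trans (cong (iter σ (suc s)) arrival≡z) σˢz≡d
    where
    s<size : s < cornerSize i
    s<size with suc s <? turns i
    ... | yes s<turns = ≤-pred (subst (suc s <_) (sym (suc-cornerSize i)) s<turns)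
    ... | no  s≮turns = ⊥-elim (true≢false (begin
      true                                     ≡⟨ next-traversed i ⟨
      traversed (W (suc (toℕ i)))              ≡⟨ cong traversed (turns-next i) ⟨
      traversed (iter σ (turns i) (arrival i)) ≡⟨ cong (traversed ∘ iter σ (turns i)) arrival≡z ⟩
      traversed (iter σ (turns i) z)           ≡⟨ untraversed (turns i) (turns-pos i) (≮⇒≥ s≮turns) ⟩
      false                                    ∎))
      where open ≡-Reasoning

  -- Turning clockwise from d, the first traversed dart is the arrival of some step, and d lies
  -- in the corner of that step.
  sector : ∀ d → interior d ∧ visits d ≡ true → ∃[ i ] ∃[ j ] (j < cornerSize i × corner i j ≡ d)
  sector d eq with ∧-true⁻ (interior d) eq
  ... | interior-d , visits-d with ∧-true⁻ (R d) interior-d | visits⁻ visits-d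
  ... | Rd , not-traversed-d | i₀ , i₀<L , a , σᵃ≡d
      with last-true (λ t → traversed (iter σ t (W i₀))) (traversed-W (<⇒≤ i₀<L)) a
  ... | t , t≤a , traversed-z , later with m≤n⇒m<n∨m≡n t≤a
  ... | inj₂ refl = ⊥-elim (true≢false (trans (sym traversed-z) (trans (cong traversed σᵃ≡d) untraversed-d)))
    where
    untraversed-d : traversed d ≡ false
    untraversed-d = trans (sym (not-involutive _)) (cong not not-traversed-d)
  ... | inj₁ t<a with a ∸ t in a∸t | m<n⇒0<n∸m t<a
  ... | suc s | _ = fan-in-corner (iter σ t (W i₀)) s traversed-z σˢz≡d Rd untraversed
    where
    σˢz≡d : iter σ (suc s) (iter σ t (W i₀)) ≡ d
    σˢz≡d = trans (cong (λ k → iter σ k (iter σ t (W i₀))) (sym a∸t)) (trans (iter-∸ σ t≤a (W i₀)) σᵃ≡d)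
    untraversed : ∀ t′ → 1 ≤ t′ → t′ ≤ suc s → traversed (iter σ t′ (iter σ t (W i₀))) ≡ false
    untraversed t′ 1≤t′ t′≤s = trans (cong traversed (sym (iter-+ σ t′ t (W i₀))))
      (later (t′ + t) (m<n+m t 1≤t′) (m≤o∸n⇒m+n≤o t′ t≤a (subst (t′ ≤_) (sym a∸t) t′≤s)))

  inCorner : Fin L → Fin n → Bool
  inCorner i d = any (λ j → corner i j == d) (upTo (cornerSize i))

  corner-indicator : ∀ i d → ∑[ j < cornerSize i ] [ corner i (toℕ j) == d ] ≡ [ inCorner i d ]
  corner-indicator i d = count-unique< (λ j → corner i j == d) (cornerSize i) (inCorner i d)
    (λ j j′ j<size j′<size c c′ → suc-injective (proj₂ (turn-unique i i (corner-index i j<size) (corner-index i j′<size)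
                                                          (trans (==⇒≡ c) (sym (==⇒≡ c′))))))
    (any-upTo⁻ (λ j → corner i j == d) (cornerSize i))
    (λ j j<size c → any-upTo⁺ (λ j → corner i j == d) (cornerSize i) j<size c)

  corners-indicator : ∀ d → ∑[ i < L ] [ inCorner i d ] ≡ [ interior d ∧ visits d ]
  corners-indicator d = count-unique (λ i → inCorner i d) (interior d ∧ visits d) unique witness sound
    where
    unique : ∀ i i′ → inCorner i d ≡ true → inCorner i′ d ≡ true → i ≡ i′
    unique i i′ c c′ =
      let j  , j<size  , cj  = any-upTo⁻ (λ j → corner i j == d) (cornerSize i) c
          j′ , j′<size , cj′ = any-upTo⁻ (λ j → corner i′ j == d) (cornerSize i′) c′
      in  proj₁ (turn-unique i i′ (corner-index i j<size) (corner-index i′ j′<size) (trans (==⇒≡ cj) (sym (==⇒≡ cj′))))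
    witness : interior d ∧ visits d ≡ true → ∃[ i ] (inCorner i d ≡ true)
    witness eq = let i , j , j<size , corner≡d = sector d eq
                 in  i , any-upTo⁺ (λ j → corner i j == d) (cornerSize i) j<size (≡⇒== corner≡d)
    sound : ∀ i → inCorner i d ≡ true → interior d ∧ visits d ≡ true
    sound i c = let j , j<size , cj = any-upTo⁻ (λ j → corner i j == d) (cornerSize i) c
                in  subst (λ e → interior e ∧ visits e ≡ true) (==⇒≡ cj) (corner-interior i j (corner-index i j<size))

  o-count : ∀ out → o M out L W ≡ count (λ d → (interior d ∧ visits d) ∧ out d)
  o-count out = begin
    o M out L W
      ≡⟨ sumᴸ-map-upTo (λ i → countᵇ out (rightCorner M L W i)) L ⟩
    ∑[ i < L ] countᵇ out (rightCorner M L W (toℕ i))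
      ≡⟨ sum-cong-≗ {L} per-corner ⟩
    ∑[ i < L ] ∑[ d < n ] ([ inCorner i d ] * [ out d ])
      ≡⟨ ∑-comm {L} {n} _ ⟩
    ∑[ d < n ] ∑[ i < L ] ([ inCorner i d ] * [ out d ])
      ≡⟨ sum-cong-≗ {n} (λ d → *-distribʳ-sum {L} [ out d ] _) ⟨
    ∑[ d < n ] (∑[ i < L ] [ inCorner i d ] * [ out d ])
      ≡⟨ sum-cong-≗ {n} (λ d → cong (_* [ out d ]) (corners-indicator d)) ⟩
    ∑[ d < n ] ([ interior d ∧ visits d ] * [ out d ])
      ≡⟨ sum-cong-≗ {n} (λ d → [∧] (interior d ∧ visits d) (out d)) ⟩
    count (λ d → (interior d ∧ visits d) ∧ out d) ∎
    where
    open ≡-Reasoning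
    per-corner : ∀ i → countᵇ out (rightCorner M L W (toℕ i)) ≡ ∑[ d < n ] ([ inCorner i d ] * [ out d ])
    per-corner i = begin
      countᵇ out (rightCorner M L W (toℕ i))
        ≡⟨ cong (countᵇ out) (rightCorner-≡ i) ⟩
      countᵇ out (applyUpTo (corner i) (cornerSize i))
        ≡⟨ countᵇ-applyUpTo out (corner i) (cornerSize i) ⟩
      ∑[ j < cornerSize i ] [ out (corner i (toℕ j)) ]
        ≡⟨ sum-reindex {cornerSize i} {n} (corner i ∘ toℕ) (λ d → [ out d ]) ⟩
      ∑[ d < n ] (∑[ j < cornerSize i ] [ corner i (toℕ j) == d ] * [ out d ])
        ≡⟨ sum-cong-≗ {n} (λ d → cong (_* [ out d ]) (corner-indicator i d)) ⟩
      ∑[ d < n ] ([ inCorner i d ] * [ out d ]) ∎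

-- Euler counting

euler-arithmetic : ∀ A B C D o V E F → 4 * F ≡ (A + B) + (C + D) → C + D ≡ 2 * E → F ≡ B + D →
                   C ≡ o + 3 * V → V + F ≡ E + 1 → 2 * (A + o + 3) ≡ 3 * (A + B)
euler-arithmetic A B C D o V E F faces edges ingoing outgoing euler =
  +-cancelʳ-≡ (3 * B + 3 * D) _ _ (begin
    2 * (A + o + 3) + (3 * B + 3 * D)   ≡⟨ cong (2 * (A + o + 3) +_) three-sides ⟩
    2 * (A + o + 3) + (A + o + 3 * V)   ≡⟨ solve (A ∷ o ∷ V ∷ []) ⟩
    3 * A + 3 * (o + V + 2)             ≡⟨ cong (λ x → 3 * A + 3 * x) two-sides ⟨
    3 * A + 3 * (2 * B + D)             ≡⟨ solve (A ∷ B ∷ D ∷ []) ⟩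
    3 * (A + B) + (3 * B + 3 * D)       ∎)
  where
  open ≡-Reasoning
  three-sides : 3 * B + 3 * D ≡ A + o + 3 * V
  three-sides = +-cancelʳ-≡ (B + D) _ _ (begin
    3 * B + 3 * D + (B + D)     ≡⟨ solve (B ∷ D ∷ []) ⟩
    4 * (B + D)                 ≡⟨ cong (4 *_) ingoing ⟨
    4 * F                       ≡⟨ faces ⟩
    A + B + (C + D)             ≡⟨ cong (λ c → A + B + (c + D)) outgoing ⟩
    A + B + (o + 3 * V + D)     ≡⟨ solve (A ∷ B ∷ o ∷ V ∷ D ∷ []) ⟩
    A + o + 3 * V + (B + D)     ∎)
  two-sides : 2 * B + D ≡ o + V + 2
  two-sides = +-cancelʳ-≡ (2 * V + D) _ _ (begin
    2 * B + D + (2 * V + D)     ≡⟨ solve (B ∷ D ∷ V ∷ []) ⟩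
    2 * (V + (B + D))           ≡⟨ cong (λ f → 2 * (V + f)) ingoing ⟨
    2 * (V + F)                 ≡⟨ cong (2 *_) euler ⟩
    2 * (E + 1)                 ≡⟨ solve (E ∷ []) ⟩
    2 * E + 2                   ≡⟨ cong (_+ 2) edges ⟨
    C + D + 2                   ≡⟨ cong (λ c → c + D + 2) outgoing ⟩
    o + 3 * V + D + 2           ≡⟨ solve (o ∷ V ∷ D ∷ []) ⟩
    o + V + 2 + (2 * V + D)     ∎)

halve : ∀ x k → 2 * (x + 3) ≡ 3 * (2 * suc k) → x ≡ 3 * k
halve x k eq = +-cancelʳ-≡ 3 _ _ (*-cancelˡ-≡ _ _ 2 (trans eq (solve (k ∷ []))))

cw+o-identity : (M : Map) → Quadrangulation M →
                (out : Fin (Map.n M) → Bool) → ThreeBiorientation M out → SQuad M out →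
                (L : ℕ) (W : ℕ → Fin (Map.n M)) (R : Fin (Map.n M) → Bool) → EnclosesDisk M L W R →
                2 * (cw M out L W + o M out L W + 3) ≡ 3 * L
cw+o-identity M quad out three squad L W R disk = begin
  2 * (cw M out L W + o M out L W + 3)
    ≡⟨ cong (λ x → 2 * (x + 3)) (cong₂ _+_ (cw-count out) (o-count out)) ⟩
  2 * (A + o′ + 3)
    ≡⟨ euler-arithmetic A B C D o′ V E F faces edges ingoing outgoing (EnclosesDisk.euler disk) ⟩
  3 * (A + B)
    ≡⟨ cong (3 *_) (trans (sym split-boundary) count-boundary) ⟩
  3 * L ∎
  where
  open ≡-Reasoning
  open Map M using (n)
  open Walk M L W R disk
  open Corners M L W R disk using (o-count)
  A B C D o′ V E F : ℕ
  A  = count (λ d → (R d ∧ traversed d) ∧ out d)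
  B  = count (λ d → (R d ∧ traversed d) ∧ not (out d))
  C  = count (λ d → interior d ∧ out d)
  D  = count (λ d → interior d ∧ not (out d))
  o′ = count (λ d → (interior d ∧ visits d) ∧ out d)
  V  = #Vint M L W R
  E  = #Eint M L W R
  F  = #Fint M L W R
  split-boundary : count (λ d → R d ∧ traversed d) ≡ A + B
  split-boundary = count-split (λ d → R d ∧ traversed d) out
  split-interior : count interior ≡ C + D
  split-interior = count-split interior out
  faces : 4 * F ≡ (A + B) + (C + D)
  faces = trans (sym (count-region quad)) (trans (count-split R traversed) (cong₂ _+_ split-boundary split-interior))
  edges : C + D ≡ 2 * E
  edges = trans (sym split-interior) count-interior
  ingoing : F ≡ B + D
  ingoing = trans (#Fint-ingoing (proj₁ three) squad) (trans (count-split (λ d → R d ∧ not (out d)) traversed)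
    (cong₂ _+_ (count-cong {n} (λ d → xy∙z≈xz∙y (R d) (not (out d)) (traversed d)))
               (count-cong {n} (λ d → xy∙z≈xz∙y (R d) (not (out d)) (not (traversed d))))))
  outgoing : C ≡ o′ + 3 * V
  outgoing = trans (count-split (λ d → interior d ∧ out d) visits)
    (cong₂ _+_ (count-cong {n} (λ d → xy∙z≈xz∙y (interior d) (out d) (visits d)))
               (trans (count-cong {n} unvisited-out) (count-unvisited-out three)))
    where
    unvisited-out : ∀ d → (interior d ∧ out d) ∧ not (visits d) ≡ unvisited d ∧ out d
    unvisited-out d = trans (xy∙z≈xz∙y (interior d) (out d) (not (visits d))) (cong (_∧ out d) (interior-unvisited d))

lemma4 : (M : Map) → Toroidal M → Quadrangulation M → Bipartite M →
         EssentiallyIrreducible M →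
         (out : Fin (Map.n M) → Bool) → ThreeBiorientation M out → SQuad M out →
         (k : ℕ) (W : ℕ → Fin (Map.n M)) (R : Fin (Map.n M) → Bool) →
         EnclosesDisk M (2 * k) W R →
         cw M out (2 * k) W + o M out (2 * k) W ≡ 3 * (k ∸ 1)
lemma4 M _ quad _ _ out three squad zero    W R disk with EnclosesDisk.nonempty disk
... | ()
lemma4 M _ quad _ _ out three squad (suc k) W R disk =
  halve _ k (cw+o-identity M quad out three squad (2 * suc k) W R disk)
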